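{- Let $n$ be a positive integer and let $A\in\{0,1\}^{n\times n}$ be such that every row of $A$ contains at most two ones. Then $|\det(A)|\leq 2^{n/3}$. -}

module Defs where

open import Data.Nat using (ℕ; zero; suc)
open import Data.Bool using (Bool; true; false; if_then_else_)
open import Data.Fin using (Fin; zero; suc; punchIn; toℕ)
open import Data.Integer using (ℤ; +_; -_; _+_; _*_)

BoolMatrix : ℕ → Set
BoolMatrix n = Fin n → Fin n → Bool

toℤ : Bool → ℤ
toℤ true  = + 1
toℤ false = + 0

countOnes : ∀ {n} → (Fin n → Bool) → ℕ
countOnes {zero}  r = 0
countOnes {suc n} r = (if r zero then 1 else 0) Data.Nat.+ countOnes (λ j → r (suc j))

sign : ℕ → ℤ
sign zero          = + 1
sign (suc zero)    = - (+ 1)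
sign (suc (suc k)) = sign k

sumFin : ∀ {m} → (Fin m → ℤ) → ℤ
sumFin {zero}  f = + 0
sumFin {suc m} f = f zero + sumFin (λ j → f (suc j))

det : ∀ {n} → (Fin n → Fin n → ℤ) → ℤ
det {zero}  M = + 1
det {suc n} M = sumFin (λ j → sign (toℕ j) * M zero j
                               * det (λ i k → M (suc i) (punchIn j k)))

module Submission where

-- Induction on n, carrying along the sharper bound 2·|det A|³ ≤ 2ⁿ when some row of A has
-- at most one 1 (expand along that row). Otherwise every row has exactly two ones, and
-- double counting yields a column a with at most two ones. A zero column or two equal rows
-- give det A = 0; a column meeting only one row lets a single expansion reduce to an
-- (n-1)-minor. In the remaining case rows r = {a, b} and i = {a, x}, and expanding along r
-- and then along i gives |det A| ≤ |det C| + |det C′| for two (n-2)-minors, each of which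
-- keeps a row that lost one of its ones (in column x, resp. b). Hence
-- |det A|³ ≤ 8·max(|det C|, |det C′|)³ ≤ 4·2ⁿ⁻² = 2ⁿ.

open import Defs
open import Data.Nat using (ℕ; _≤_; _^_; NonZero)
open import Data.Fin using (Fin)
open import Data.Integer using (∣_∣)

open import Data.Nat using (zero; suc; z≤n; s≤s)
open import Data.Bool using (Bool; true; false; if_then_else_)
open import Data.Empty using (⊥-elim)
open import Data.Fin using (zero; suc; toℕ; punchIn; punchOut; _≟_)
open import Data.Fin.Properties
  using (punchInᵢ≢i; punchIn-injective; punchIn-punchOut; punchOut-punchIn; punchOut-cong; punchOut-injective; any?)
open import Data.Integer using (ℤ; 0ℤ; 1ℤ; +0; -_; _+_; _*_)
import Data.Integer.Properties as ℤ
open import Data.Integer.Tactic.RingSolver using (solve-∀)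
import Data.Nat as ℕ
import Data.Nat.Properties as ℕ
import Data.Nat.Tactic.RingSolver as ℕ-Solver
open import Algebra.Properties.CommutativeMonoid.Sum ℕ.+-0-commutativeMonoid using (sum; ∑-comm; sum-cong-≗)
open import Data.Product using (∃; _,_; proj₁; proj₂)
open import Data.Sum using (_⊎_; inj₁; inj₂)
open import Function using (_∘_)
open import Relation.Binary.PropositionalEquality
open import Relation.Nullary using (¬_; yes; no)

punchOut-punchIn′ : ∀ {n} (i : Fin (suc n)) {j} (i≢ : i ≢ punchIn i j) → punchOut i≢ ≡ j
punchOut-punchIn′ i i≢ = trans (punchOut-cong i refl) (punchOut-punchIn i)

punchIn≢-of-≢punchOut : ∀ {n} {c j : Fin (suc n)} (c≢j : c ≢ j) {l} → l ≢ punchOut c≢j → punchIn c l ≢ j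
punchIn≢-of-≢punchOut {c = c} c≢j {l} l≢ eq =
  l≢ (punchIn-injective c l _ (trans eq (sym (punchIn-punchOut c≢j))))

punchIn²-surjective : ∀ {n} {r : Fin (suc (suc n))} {l j} → j ≢ r → j ≢ punchIn r l →
  ∃ λ k → punchIn r (punchIn l k) ≡ j
punchIn²-surjective {r = r} {l} {j} j≢r j≢rl =
  punchOut l≢j′ , trans (cong (punchIn r) (punchIn-punchOut l≢j′)) (punchIn-punchOut r≢j)
  where
  r≢j = j≢r ∘ sym
  l≢j′ : l ≢ punchOut r≢j
  l≢j′ l≡j′ = j≢rl (trans (sym (punchIn-punchOut r≢j)) (cong (punchIn r) (sym l≡j′)))

sumFin-cong : ∀ {m} {f g : Fin m → ℤ} → (∀ j → f j ≡ g j) → sumFin f ≡ sumFin g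
sumFin-cong {zero}  f≗g = refl
sumFin-cong {suc m} f≗g = cong₂ _+_ (f≗g zero) (sumFin-cong (f≗g ∘ suc))

sumFin-zero : ∀ {m} {f : Fin m → ℤ} → (∀ j → f j ≡ 0ℤ) → sumFin f ≡ 0ℤ
sumFin-zero {zero}  f≗0 = refl
sumFin-zero {suc m} f≗0 = cong₂ _+_ (f≗0 zero) (sumFin-zero (f≗0 ∘ suc))

sumFin-+ : ∀ {m} (f g : Fin m → ℤ) → sumFin (λ j → f j + g j) ≡ sumFin f + sumFin g
sumFin-+ {zero}  f g = refl
sumFin-+ {suc m} f g = begin
  f zero + g zero + sumFin (λ j → f (suc j) + g (suc j))
    ≡⟨ cong ((f zero + g zero) +_) (sumFin-+ (f ∘ suc) (g ∘ suc)) ⟩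
  f zero + g zero + (sumFin (f ∘ suc) + sumFin (g ∘ suc))
    ≡⟨ interchange (f zero) (g zero) _ _ ⟩
  f zero + sumFin (f ∘ suc) + (g zero + sumFin (g ∘ suc)) ∎
  where
  open ≡-Reasoning
  interchange : ∀ a b c d → a + b + (c + d) ≡ a + c + (b + d)
  interchange = solve-∀

sumFin-*ˡ : ∀ {m} c (f : Fin m → ℤ) → sumFin (λ j → c * f j) ≡ c * sumFin f
sumFin-*ˡ {zero}  c f = sym (ℤ.*-zeroʳ c)
sumFin-*ˡ {suc m} c f =
  trans (cong (c * f zero +_) (sumFin-*ˡ c (f ∘ suc))) (sym (ℤ.*-distribˡ-+ c _ _))

sumFin-neg : ∀ {m} (f : Fin m → ℤ) → sumFin (λ j → - f j) ≡ - sumFin f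
sumFin-neg {zero}  f = refl
sumFin-neg {suc m} f =
  trans (cong (- f zero +_) (sumFin-neg (f ∘ suc))) (sym (ℤ.neg-distrib-+ (f zero) _))

sumFin-comm : ∀ {m k} (g : Fin m → Fin k → ℤ) →
  sumFin (λ i → sumFin (g i)) ≡ sumFin (λ j → sumFin (λ i → g i j))
sumFin-comm {zero} {k} g = sym (sumFin-zero {k} (λ _ → refl))
sumFin-comm {suc m} g =
  trans (cong (sumFin (g zero) +_) (sumFin-comm (g ∘ suc)))
        (sym (sumFin-+ (g zero) (λ j → sumFin (λ i → g (suc i) j))))

sumFin-punchIn : ∀ {m} (f : Fin (suc m) → ℤ) c → sumFin f ≡ f c + sumFin (f ∘ punchIn c)
sumFin-punchIn         f zero    = refl
sumFin-punchIn {suc m} f (suc c) =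
  trans (cong (f zero +_) (sumFin-punchIn (f ∘ suc) c)) (left-comm (f zero) (f (suc c)) _)
  where
  left-comm : ∀ a b s → a + (b + s) ≡ b + (a + s)
  left-comm = solve-∀

sumFin-single : ∀ {m} (f : Fin (suc m) → ℤ) c → (∀ j → j ≢ c → f j ≡ 0ℤ) → sumFin f ≡ f c
sumFin-single f c f≡0 = begin
  sumFin f                        ≡⟨ sumFin-punchIn f c ⟩
  f c + sumFin (f ∘ punchIn c)    ≡⟨ cong (f c +_) (sumFin-zero (λ l → f≡0 _ (punchInᵢ≢i c l))) ⟩
  f c + 0ℤ                        ≡⟨ ℤ.+-identityʳ (f c) ⟩
  f c                             ∎
  where open ≡-Reasoning

sumFin-pair : ∀ {m} (f : Fin (suc m) → ℤ) {a b} → a ≢ b → (∀ j → j ≢ a → j ≢ b → f j ≡ 0ℤ) →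
  sumFin f ≡ f a + f b
sumFin-pair {zero}  f {zero} {zero} a≢b f≡0 = ⊥-elim (a≢b refl)
sumFin-pair {suc m} f {a}    {b}    a≢b f≡0 = begin
  sumFin f                                  ≡⟨ sumFin-punchIn f a ⟩
  f a + sumFin (f ∘ punchIn a)              ≡⟨ cong (f a +_) (sumFin-single (f ∘ punchIn a) b′ rest≡0) ⟩
  f a + f (punchIn a b′)                    ≡⟨ cong (λ j → f a + f j) (punchIn-punchOut a≢b) ⟩
  f a + f b                                 ∎
  where
  open ≡-Reasoning
  b′ = punchOut a≢b
  rest≡0 : ∀ l → l ≢ b′ → f (punchIn a l) ≡ 0ℤ
  rest≡0 l l≢b′ = f≡0 _ (punchInᵢ≢i a l) (punchIn≢-of-≢punchOut a≢b l≢b′)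

sign-suc : ∀ k → sign (suc k) ≡ - sign k
sign-suc zero          = refl
sign-suc (suc zero)    = refl
sign-suc (suc (suc k)) = sign-suc k

∣sign*i∣≡∣i∣ : ∀ k i → ∣ sign k * i ∣ ≡ ∣ i ∣
∣sign*i∣≡∣i∣ zero          i = cong ∣_∣ (ℤ.*-identityˡ i)
∣sign*i∣≡∣i∣ (suc zero)    i = trans (cong ∣_∣ (ℤ.-1*i≡-i i)) (ℤ.∣-i∣≡∣i∣ i)
∣sign*i∣≡∣i∣ (suc (suc k)) i = ∣sign*i∣≡∣i∣ k i

i≡-i⇒i≡0 : ∀ {i} → i ≡ - i → i ≡ 0ℤ
i≡-i⇒i≡0 {+0} _ = refl

skip₂ : ∀ {m} {a b : Fin (suc (suc m))} → a ≢ b → Fin m → Fin (suc (suc m))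
skip₂ {a = a} a≢b = punchIn a ∘ punchIn (punchOut a≢b)

skip₂-sym : ∀ {m} {a b : Fin (suc (suc m))} (a≢b : a ≢ b) (b≢a : b ≢ a) c →
  skip₂ a≢b c ≡ skip₂ b≢a c
skip₂-sym {a = zero}  {zero}  a≢b b≢a c = ⊥-elim (a≢b refl)
skip₂-sym {a = zero}  {suc b} a≢b b≢a c = refl
skip₂-sym {a = suc a} {zero}  a≢b b≢a c = refl
skip₂-sym {suc m} {suc a} {suc b} a≢b b≢a zero    = refl
skip₂-sym {suc m} {suc a} {suc b} a≢b b≢a (suc c) =
  cong suc (skip₂-sym (a≢b ∘ cong suc) (b≢a ∘ cong suc) c)

sign₂ : ∀ {m} {a b : Fin (suc (suc m))} → a ≢ b → ℤ
sign₂ {a = a} a≢b = sign (toℕ a) * sign (toℕ (punchOut a≢b))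

sign₂-antisym : ∀ {m} {a b : Fin (suc (suc m))} (a≢b : a ≢ b) (b≢a : b ≢ a) →
  sign₂ a≢b ≡ - sign₂ b≢a
sign₂-antisym {a = zero}  {zero}  a≢b b≢a = ⊥-elim (a≢b refl)
sign₂-antisym {a = zero}  {suc b} a≢b b≢a =
  trans (negate-swap (sign (toℕ b))) (cong (λ s → - (s * 1ℤ)) (sym (sign-suc (toℕ b))))
  where
  negate-swap : ∀ s → 1ℤ * s ≡ - (- s * 1ℤ)
  negate-swap = solve-∀
sign₂-antisym {a = suc a} {zero}  a≢b b≢a =
  trans (cong (_* 1ℤ) (sign-suc (toℕ a))) (negate-swap (sign (toℕ a)))
  where
  negate-swap : ∀ s → - s * 1ℤ ≡ - (1ℤ * s)
  negate-swap = solve-∀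
sign₂-antisym {zero}  {suc zero} {suc zero} a≢b b≢a = ⊥-elim (a≢b refl)
sign₂-antisym {suc m} {suc a}    {suc b}    a≢b b≢a = begin
  sign (suc (toℕ a)) * sign (suc (toℕ a′))  ≡⟨ cong₂ _*_ (sign-suc (toℕ a)) (sign-suc (toℕ a′)) ⟩
  - sign (toℕ a) * - sign (toℕ a′)          ≡⟨ neg*neg (sign (toℕ a)) (sign (toℕ a′)) ⟩
  sign₂ a≢b′                                ≡⟨ sign₂-antisym a≢b′ b≢a′ ⟩
  - (sign (toℕ b) * sign (toℕ b′))          ≡⟨ cong -_ (neg*neg (sign (toℕ b)) (sign (toℕ b′))) ⟨
  - (- sign (toℕ b) * - sign (toℕ b′))      ≡⟨ cong₂ (λ s t → - (s * t)) (sign-suc (toℕ b)) (sign-suc (toℕ b′)) ⟨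
  - (sign (suc (toℕ b)) * sign (suc (toℕ b′))) ∎
  where
  open ≡-Reasoning
  a≢b′ = a≢b ∘ cong suc
  b≢a′ = b≢a ∘ cong suc
  a′ = punchOut a≢b′
  b′ = punchOut b≢a′
  neg*neg : ∀ s t → - s * - t ≡ s * t
  neg*neg = solve-∀

-- Laplace expansion along two rows u, v of an (m+2)×(m+2) matrix, where D gives the
-- determinant of the remaining m rows restricted to a choice of m columns. Its antisymmetry
-- in (u, v) yields expansion along any row and the vanishing of det on equal rows.
expand₂ : ∀ {m} → ((Fin m → Fin (suc (suc m))) → ℤ) → (u v : Fin (suc (suc m)) → ℤ) → ℤ
expand₂ D u v = sumFin λ j → sign (toℕ j) * u j *
                  sumFin λ l → sign (toℕ l) * v (punchIn j l) * D (punchIn j ∘ punchIn l)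

module _ {m} (D : (Fin m → Fin (suc (suc m))) → ℤ)
             (D-cong : ∀ {f g} → (∀ c → f c ≡ g c) → D f ≡ D g) where

  coeff : (a b : Fin (suc (suc m))) → ℤ
  coeff a b with a ≟ b
  ... | yes _   = 0ℤ
  ... | no a≢b = sign₂ a≢b * D (skip₂ a≢b)

  coeff-diag : ∀ a → coeff a a ≡ 0ℤ
  coeff-diag a with a ≟ a
  ... | yes _   = refl
  ... | no a≢a = ⊥-elim (a≢a refl)

  coeff-punchIn : ∀ j l → coeff j (punchIn j l) ≡ sign (toℕ j) * sign (toℕ l) * D (punchIn j ∘ punchIn l)
  coeff-punchIn j l with j ≟ punchIn j l
  ... | yes j≡ = ⊥-elim (punchInᵢ≢i j l (sym j≡))
  ... | no j≢  = cong (λ l′ → sign (toℕ j) * sign (toℕ l′) * D (punchIn j ∘ punchIn l′))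
                      (punchOut-punchIn′ j j≢)

  coeff-antisym : ∀ a b → coeff a b ≡ - coeff b a
  coeff-antisym a b with a ≟ b | b ≟ a
  ... | yes _   | yes _   = refl
  ... | yes a≡b | no b≢a = ⊥-elim (b≢a (sym a≡b))
  ... | no a≢b | yes b≡a = ⊥-elim (a≢b (sym b≡a))
  ... | no a≢b | no b≢a = begin
    sign₂ a≢b * D (skip₂ a≢b)     ≡⟨ cong₂ _*_ (sign₂-antisym a≢b b≢a) (D-cong (skip₂-sym a≢b b≢a)) ⟩
    - sign₂ b≢a * D (skip₂ b≢a)   ≡⟨ ℤ.neg-distribˡ-* (sign₂ b≢a) _ ⟨
    - (sign₂ b≢a * D (skip₂ b≢a)) ∎
    where open ≡-Reasoning

  bilinear : (u v : Fin (suc (suc m)) → ℤ) → ℤ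
  bilinear u v = sumFin λ a → sumFin λ b → u a * v b * coeff a b

  expand₂≡bilinear : ∀ u v → expand₂ D u v ≡ bilinear u v
  expand₂≡bilinear u v = sumFin-cong row
    where
    open ≡-Reasoning
    regroup : ∀ s x t y d → s * x * (t * y * d) ≡ x * y * (s * t * d)
    regroup = solve-∀
    row : ∀ j → sign (toℕ j) * u j * sumFin (λ l → sign (toℕ l) * v (punchIn j l) * D (punchIn j ∘ punchIn l))
              ≡ sumFin (λ b → u j * v b * coeff j b)
    row j = begin
      sign (toℕ j) * u j * sumFin term                 ≡⟨ sumFin-*ˡ (sign (toℕ j) * u j) term ⟨
      sumFin (λ l → sign (toℕ j) * u j * term l)       ≡⟨ sumFin-cong regroup′ ⟩
      sumFin (w ∘ punchIn j)                           ≡⟨ ℤ.+-identityˡ (sumFin (w ∘ punchIn j)) ⟨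
      0ℤ + sumFin (w ∘ punchIn j)                      ≡⟨ cong (_+ sumFin (w ∘ punchIn j)) w-diag ⟨
      w j + sumFin (w ∘ punchIn j)                     ≡⟨ sumFin-punchIn w j ⟨
      sumFin w                                         ∎
      where
      term : Fin (suc m) → ℤ
      term l = sign (toℕ l) * v (punchIn j l) * D (punchIn j ∘ punchIn l)
      w : Fin (suc (suc m)) → ℤ
      w b = u j * v b * coeff j b
      w-diag : w j ≡ 0ℤ
      w-diag = trans (cong (u j * v j *_) (coeff-diag j)) (ℤ.*-zeroʳ (u j * v j))
      regroup′ : ∀ l → sign (toℕ j) * u j * term l ≡ w (punchIn j l)
      regroup′ l = trans (regroup (sign (toℕ j)) (u j) (sign (toℕ l)) (v (punchIn j l)) (D (punchIn j ∘ punchIn l)))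
                         (cong (u j * v (punchIn j l) *_) (sym (coeff-punchIn j l)))

  bilinear-antisym : ∀ u v → bilinear v u ≡ - bilinear u v
  bilinear-antisym u v = begin
    bilinear v u                                            ≡⟨ sumFin-comm (λ a b → v a * u b * coeff a b) ⟩
    sumFin (λ b → sumFin λ a → v a * u b * coeff a b)       ≡⟨ sumFin-cong (λ b → sumFin-cong (λ a → swap b a)) ⟩
    sumFin (λ b → sumFin λ a → - (u b * v a * coeff b a))   ≡⟨ sumFin-cong (λ b → sumFin-neg (λ a → u b * v a * coeff b a)) ⟩
    sumFin (λ b → - sumFin λ a → u b * v a * coeff b a)     ≡⟨ sumFin-neg (λ b → sumFin λ a → u b * v a * coeff b a) ⟩
    - bilinear u v                                          ∎
    where
    open ≡-Reasoning
    negate : ∀ x y c → y * x * - c ≡ - (x * y * c)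
    negate = solve-∀
    swap : ∀ b a → v a * u b * coeff a b ≡ - (u b * v a * coeff b a)
    swap b a = trans (cong (v a * u b *_) (coeff-antisym a b)) (negate (u b) (v a) (coeff b a))

  expand₂-antisym : ∀ u v → expand₂ D v u ≡ - expand₂ D u v
  expand₂-antisym u v = begin
    expand₂ D v u    ≡⟨ expand₂≡bilinear v u ⟩
    bilinear v u     ≡⟨ bilinear-antisym u v ⟩
    - bilinear u v   ≡⟨ cong -_ (expand₂≡bilinear u v) ⟨
    - expand₂ D u v  ∎
    where open ≡-Reasoning

  expand₂-equal : ∀ u v → (∀ j → u j ≡ v j) → expand₂ D u v ≡ 0ℤ
  expand₂-equal u v u≗v = i≡-i⇒i≡0 (trans swapRows (expand₂-antisym u v))
    where
    swapRows : expand₂ D u v ≡ expand₂ D v u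
    swapRows = sumFin-cong λ j → cong₂ (λ x s → sign (toℕ j) * x * s) (u≗v j)
      (sumFin-cong λ l → cong (λ y → sign (toℕ l) * y * D (punchIn j ∘ punchIn l)) (sym (u≗v (punchIn j l))))

Matrix : ℕ → Set
Matrix n = Fin n → Fin n → ℤ

minor : ∀ {A : Set} {n} → (Fin (suc n) → Fin (suc n) → A) → Fin (suc n) → Fin (suc n) → Fin n → Fin n → A
minor M r c i k = M (punchIn r i) (punchIn c k)

toTop : ∀ {n} → Fin (suc n) → Matrix (suc n) → Matrix (suc n)
toTop r M zero    = M r
toTop r M (suc i) = M (punchIn r i)

det-cong : ∀ {n} {M N : Matrix n} → (∀ i j → M i j ≡ N i j) → det M ≡ det N
det-cong {zero}  M≗N = refl
det-cong {suc n} M≗N = sumFin-cong λ j →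
  cong₂ (λ x d → sign (toℕ j) * x * d) (M≗N zero j) (det-cong (λ i k → M≗N (suc i) (punchIn j k)))

lowerMinor : ∀ {m} → Matrix (suc (suc m)) → Fin (suc m) → (Fin m → Fin (suc (suc m))) → ℤ
lowerMinor M k cols = det (λ i c → M (suc (punchIn k i)) (cols c))

lowerMinor-cong : ∀ {m} (M : Matrix (suc (suc m))) k {f g} → (∀ c → f c ≡ g c) →
  lowerMinor M k f ≡ lowerMinor M k g
lowerMinor-cong M k f≗g = det-cong (λ i c → cong (M (suc (punchIn k i))) (f≗g c))

-- det (toTop (suc k) M) unfolds definitionally to expand₂ (lowerMinor M k) (M (suc k)) (M zero),
-- so antisymmetry of expand₂ moves row suc k to the top; det≡expand₂ needs det-toTop only
-- on the smaller minors.
mutual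
  det≡expand₂ : ∀ {m} (M : Matrix (suc (suc m))) k →
    det M ≡ sign (toℕ k) * expand₂ (lowerMinor M k) (M zero) (M (suc k))
  det≡expand₂ M k = begin
    det M
      ≡⟨ sumFin-cong (λ j → cong (sign (toℕ j) * M zero j *_) (det-toTop (minor M zero j) k)) ⟩
    sumFin (λ j → sign (toℕ j) * M zero j * (sign (toℕ k) * T j))
      ≡⟨ sumFin-cong (λ j → left-comm (sign (toℕ j) * M zero j) (sign (toℕ k)) (T j)) ⟩
    sumFin (λ j → sign (toℕ k) * (sign (toℕ j) * M zero j * T j))
      ≡⟨ sumFin-*ˡ (sign (toℕ k)) (λ j → sign (toℕ j) * M zero j * T j) ⟩
    sign (toℕ k) * expand₂ (lowerMinor M k) (M zero) (M (suc k)) ∎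
    where
    open ≡-Reasoning
    T : Fin (suc (suc _)) → ℤ
    T j = det (toTop k (minor M zero j))
    left-comm : ∀ x s t → x * (s * t) ≡ s * (x * t)
    left-comm = solve-∀

  det-toTop : ∀ {n} (M : Matrix (suc n)) r → det M ≡ sign (toℕ r) * det (toTop r M)
  det-toTop         M zero    = sym (ℤ.*-identityˡ (det M))
  det-toTop {suc m} M (suc k) = begin
    det M                                       ≡⟨ det≡expand₂ M k ⟩
    sign (toℕ k) * E (M zero) (M (suc k))       ≡⟨ cong (sign (toℕ k) *_)
                                                     (expand₂-antisym D (lowerMinor-cong M k) (M (suc k)) (M zero)) ⟩
    sign (toℕ k) * - E (M (suc k)) (M zero)     ≡⟨ ℤ.neg-distribʳ-* (sign (toℕ k)) _ ⟨
    - (sign (toℕ k) * E (M (suc k)) (M zero))   ≡⟨ ℤ.neg-distribˡ-* (sign (toℕ k)) _ ⟩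
    - sign (toℕ k) * E (M (suc k)) (M zero)     ≡⟨ cong (_* E (M (suc k)) (M zero)) (sign-suc (toℕ k)) ⟨
    sign (suc (toℕ k)) * det (toTop (suc k) M)  ∎
    where
    open ≡-Reasoning
    D = lowerMinor M k
    E = expand₂ D

rowTerm : ∀ {n} → Matrix (suc n) → Fin (suc n) → Fin (suc n) → ℤ
rowTerm M r j = sign (toℕ j) * M r j * det (minor M r j)

∣det∣-rowExpansion : ∀ {n} (M : Matrix (suc n)) r → ∣ det M ∣ ≡ ∣ sumFin (rowTerm M r) ∣
∣det∣-rowExpansion M r = trans (cong ∣_∣ (det-toTop M r)) (∣sign*i∣≡∣i∣ (toℕ r) _)

rowTerm-zero : ∀ {n} (M : Matrix (suc n)) r j → M r j ≡ 0ℤ → rowTerm M r j ≡ 0ℤ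
rowTerm-zero M r j Mrj≡0 =
  trans (cong (λ x → sign (toℕ j) * x * det (minor M r j)) Mrj≡0)
        (cong (_* det (minor M r j)) (ℤ.*-zeroʳ (sign (toℕ j))))

∣rowTerm∣-one : ∀ {n} (M : Matrix (suc n)) r j → M r j ≡ 1ℤ → ∣ rowTerm M r j ∣ ≡ ∣ det (minor M r j) ∣
∣rowTerm∣-one M r j Mrj≡1 = begin
  ∣ sign (toℕ j) * M r j * det (minor M r j) ∣ ≡⟨ cong (λ x → ∣ sign (toℕ j) * x * det (minor M r j) ∣) Mrj≡1 ⟩
  ∣ sign (toℕ j) * 1ℤ * det (minor M r j) ∣    ≡⟨ cong (λ s → ∣ s * det (minor M r j) ∣) (ℤ.*-identityʳ (sign (toℕ j))) ⟩
  ∣ sign (toℕ j) * det (minor M r j) ∣         ≡⟨ ∣sign*i∣≡∣i∣ (toℕ j) _ ⟩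
  ∣ det (minor M r j) ∣                        ∎
  where open ≡-Reasoning

det-zeroRow : ∀ {n} (M : Matrix (suc n)) r → (∀ j → M r j ≡ 0ℤ) → det M ≡ 0ℤ
det-zeroRow M r row≡0 = ℤ.∣i∣≡0⇒i≡0 (trans (∣det∣-rowExpansion M r)
  (cong ∣_∣ (sumFin-zero (λ j → rowTerm-zero M r j (row≡0 j)))))

det-zeroColumn : ∀ {n} (M : Matrix n) c → (∀ i → M i c ≡ 0ℤ) → det M ≡ 0ℤ
det-zeroColumn {suc n} M c col≡0 = sumFin-zero term≡0
  where
  term≡0 : ∀ j → sign (toℕ j) * M zero j * det (minor M zero j) ≡ 0ℤ
  term≡0 j with j ≟ c
  ... | yes refl = rowTerm-zero M zero j (col≡0 zero)
  ... | no j≢c  = trans (cong (sign (toℕ j) * M zero j *_) minor≡0) (ℤ.*-zeroʳ (sign (toℕ j) * M zero j))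
    where
    minor≡0 : det (minor M zero j) ≡ 0ℤ
    minor≡0 = det-zeroColumn (minor M zero j) (punchOut j≢c)
      (λ i → trans (cong (M (suc i)) (punchIn-punchOut j≢c)) (col≡0 (suc i)))

det-equalRows : ∀ {n} (M : Matrix n) {r s} → r ≢ s → (∀ j → M r j ≡ M s j) → det M ≡ 0ℤ
det-equalRows {suc zero}    M {zero} {zero} r≢s _ = ⊥-elim (r≢s refl)
det-equalRows {suc (suc m)} M {r}    {s}    r≢s rows≡ = begin
  det M                                         ≡⟨ det-toTop M r ⟩
  sign (toℕ r) * det N                          ≡⟨ cong (sign (toℕ r) *_) (det≡expand₂ N k) ⟩
  sign (toℕ r) * (sign (toℕ k) * expand₂ (lowerMinor N k) (N zero) (N (suc k)))
    ≡⟨ cong (λ e → sign (toℕ r) * (sign (toℕ k) * e))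
            (expand₂-equal (lowerMinor N k) (lowerMinor-cong N k) (N zero) (N (suc k)) top≡) ⟩
  sign (toℕ r) * (sign (toℕ k) * 0ℤ)            ≡⟨ cong (sign (toℕ r) *_) (ℤ.*-zeroʳ (sign (toℕ k))) ⟩
  sign (toℕ r) * 0ℤ                             ≡⟨ ℤ.*-zeroʳ (sign (toℕ r)) ⟩
  0ℤ                                            ∎
  where
  open ≡-Reasoning
  N = toTop r M
  k = punchOut r≢s
  top≡ : ∀ j → N zero j ≡ N (suc k) j
  top≡ j = trans (rows≡ j) (cong (λ i → M i j) (sym (punchIn-punchOut r≢s)))

∣det∣-singleEntry : ∀ {n} (M : Matrix (suc n)) r c → M r c ≡ 1ℤ → (∀ j → j ≢ c → M r j ≡ 0ℤ) →
  ∣ det M ∣ ≡ ∣ det (minor M r c) ∣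
∣det∣-singleEntry M r c Mrc≡1 rest≡0 = begin
  ∣ det M ∣                 ≡⟨ ∣det∣-rowExpansion M r ⟩
  ∣ sumFin (rowTerm M r) ∣  ≡⟨ cong ∣_∣ (sumFin-single (rowTerm M r) c (λ j j≢c → rowTerm-zero M r j (rest≡0 j j≢c))) ⟩
  ∣ rowTerm M r c ∣         ≡⟨ ∣rowTerm∣-one M r c Mrc≡1 ⟩
  ∣ det (minor M r c) ∣     ∎
  where open ≡-Reasoning

∣det∣-twoEntries : ∀ {n} (M : Matrix (suc n)) r {a b} → a ≢ b → M r a ≡ 1ℤ → M r b ≡ 1ℤ →
  (∀ j → j ≢ a → j ≢ b → M r j ≡ 0ℤ) → ∣ det M ∣ ≤ ∣ det (minor M r a) ∣ ℕ.+ ∣ det (minor M r b) ∣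
∣det∣-twoEntries M r {a} {b} a≢b Mra≡1 Mrb≡1 rest≡0 = begin
  ∣ det M ∣                                        ≡⟨ ∣det∣-rowExpansion M r ⟩
  ∣ sumFin (rowTerm M r) ∣                         ≡⟨ cong ∣_∣ (sumFin-pair (rowTerm M r) a≢b
                                                        (λ j j≢a j≢b → rowTerm-zero M r j (rest≡0 j j≢a j≢b))) ⟩
  ∣ rowTerm M r a + rowTerm M r b ∣                ≤⟨ ℤ.∣i+j∣≤∣i∣+∣j∣ (rowTerm M r a) (rowTerm M r b) ⟩
  ∣ rowTerm M r a ∣ ℕ.+ ∣ rowTerm M r b ∣          ≡⟨ cong₂ ℕ._+_ (∣rowTerm∣-one M r a Mra≡1) (∣rowTerm∣-one M r b Mrb≡1) ⟩
  ∣ det (minor M r a) ∣ ℕ.+ ∣ det (minor M r b) ∣  ∎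
  where open ℕ.≤-Reasoning

ind : Bool → ℕ
ind b = if b then 1 else 0

countOnes-punchIn : ∀ {n} (f : Fin (suc n) → Bool) c → countOnes f ≡ ind (f c) ℕ.+ countOnes (f ∘ punchIn c)
countOnes-punchIn         f zero    = refl
countOnes-punchIn {suc n} f (suc c) =
  trans (cong (ind (f zero) ℕ.+_) (countOnes-punchIn (f ∘ suc) c)) (left-comm (ind (f zero)) (ind (f (suc c))) _)
  where
  left-comm : ∀ x y z → x ℕ.+ (y ℕ.+ z) ≡ y ℕ.+ (x ℕ.+ z)
  left-comm = ℕ-Solver.solve-∀

countOnes-punchIn-≤ : ∀ {n} (f : Fin (suc n) → Bool) c → countOnes (f ∘ punchIn c) ≤ countOnes f
countOnes-punchIn-≤ f c = ℕ.≤-trans (ℕ.m≤n+m _ (ind (f c))) (ℕ.≤-reflexive (sym (countOnes-punchIn f c)))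

countOnes-punchIn-true : ∀ {n} (f : Fin (suc n) → Bool) {c} → f c ≡ true →
  countOnes f ≡ suc (countOnes (f ∘ punchIn c))
countOnes-punchIn-true f {c} fc≡true = trans (countOnes-punchIn f c) (cong (λ b → ind b ℕ.+ countOnes (f ∘ punchIn c)) fc≡true)

countOnes-punchIn-< : ∀ {n} (f : Fin (suc n) → Bool) {c} → f c ≡ true → countOnes (f ∘ punchIn c) ℕ.< countOnes f
countOnes-punchIn-< f fc≡true = ℕ.≤-reflexive (sym (countOnes-punchIn-true f fc≡true))

countOnes-dropTwo≤1 : ∀ {n} (f : Fin (suc (suc n)) → Bool) c d → countOnes f ≤ 2 →
  f c ≡ true ⊎ f (punchIn c d) ≡ true → countOnes (f ∘ punchIn c ∘ punchIn d) ≤ 1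
countOnes-dropTwo≤1 f c d count≤2 (inj₁ fc≡true) = ℕ.≤-pred (begin-strict
  countOnes (f ∘ punchIn c ∘ punchIn d)  ≤⟨ countOnes-punchIn-≤ (f ∘ punchIn c) d ⟩
  countOnes (f ∘ punchIn c)              <⟨ countOnes-punchIn-< f fc≡true ⟩
  countOnes f                            ≤⟨ count≤2 ⟩
  2                                      ∎)
  where open ℕ.≤-Reasoning
countOnes-dropTwo≤1 f c d count≤2 (inj₂ fcd≡true) = ℕ.≤-pred (begin-strict
  countOnes (f ∘ punchIn c ∘ punchIn d)  <⟨ countOnes-punchIn-< (f ∘ punchIn c) fcd≡true ⟩
  countOnes (f ∘ punchIn c)              ≤⟨ countOnes-punchIn-≤ f c ⟩
  countOnes f                            ≤⟨ count≤2 ⟩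
  2                                      ∎)
  where open ℕ.≤-Reasoning

countOnes-allFalse : ∀ {n} (f : Fin n → Bool) → (∀ j → f j ≡ false) → countOnes f ≡ 0
countOnes-allFalse {zero}  f _       = refl
countOnes-allFalse {suc n} f allFalse =
  cong₂ (λ b k → ind b ℕ.+ k) (allFalse zero) (countOnes-allFalse (f ∘ suc) (allFalse ∘ suc))

countOnes≤0⇒allFalse : ∀ {n} (f : Fin n → Bool) → countOnes f ≤ 0 → ∀ j → f j ≡ false
countOnes≤0⇒allFalse {suc n} f count≤0 j with f j in fj
... | false = refl
... | true  with () ← ℕ.<-≤-trans (countOnes-punchIn-< f fj) count≤0

allFalse⊎someTrue : ∀ {n} (f : Fin n → Bool) → (∀ j → f j ≡ false) ⊎ ∃ λ j → f j ≡ true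
allFalse⊎someTrue {zero}  f = inj₁ λ ()
allFalse⊎someTrue {suc n} f with f zero in f0 | allFalse⊎someTrue (f ∘ suc)
... | true  | _              = inj₂ (zero , f0)
... | false | inj₁ allFalse  = inj₁ λ { zero → f0 ; (suc j) → allFalse j }
... | false | inj₂ (j , fj) = inj₂ (suc j , fj)

distinct-by : ∀ {X : Set} (f : X → Bool) {x y} → f x ≡ true → f y ≡ false → x ≢ y
distinct-by f fx≡true fy≡false refl with () ← trans (sym fx≡true) fy≡false

record OneAt {n} (f : Fin n → Bool) (c : Fin n) : Set where
  constructor oneAt
  field
    hit  : f c ≡ true
    rest : ∀ j → j ≢ c → f j ≡ false

record OnesAt {n} (f : Fin n → Bool) (a b : Fin n) : Set where
  constructor onesAt
  field
    distinct : a ≢ b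
    hit₁     : f a ≡ true
    hit₂     : f b ≡ true
    rest     : ∀ j → j ≢ a → j ≢ b → f j ≡ false

oneAt-of-countOnes≤1 : ∀ {n} (f : Fin (suc n) → Bool) {c} → countOnes f ≤ 1 → f c ≡ true → OneAt f c
oneAt-of-countOnes≤1 f {c} count≤1 fc≡true = oneAt fc≡true rest
  where
  others≤0 : countOnes (f ∘ punchIn c) ≤ 0
  others≤0 = ℕ.≤-pred (ℕ.<-≤-trans (countOnes-punchIn-< f fc≡true) count≤1)
  rest : ∀ j → j ≢ c → f j ≡ false
  rest j j≢c = trans (sym (cong f (punchIn-punchOut (j≢c ∘ sym))))
                     (countOnes≤0⇒allFalse (f ∘ punchIn c) others≤0 _)

onesAt-of-countOnes≤2 : ∀ {n} (f : Fin (suc n) → Bool) {a b} → countOnes f ≤ 2 → a ≢ b →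
  f a ≡ true → f b ≡ true → OnesAt f a b
onesAt-of-countOnes≤2 {zero}  f {zero} {zero} _ a≢b _ _ = ⊥-elim (a≢b refl)
onesAt-of-countOnes≤2 {suc n} f {a}    {b}    count≤2 a≢b fa≡true fb≡true = onesAt a≢b fa≡true fb≡true rest
  where
  others : OneAt (f ∘ punchIn a) (punchOut a≢b)
  others = oneAt-of-countOnes≤1 (f ∘ punchIn a)
    (ℕ.≤-pred (ℕ.<-≤-trans (countOnes-punchIn-< f fa≡true) count≤2))
    (trans (cong f (punchIn-punchOut a≢b)) fb≡true)
  rest : ∀ j → j ≢ a → j ≢ b → f j ≡ false
  rest j j≢a j≢b = trans (sym (cong f (punchIn-punchOut (j≢a ∘ sym))))
    (OneAt.rest others _ (j≢b ∘ punchOut-injective (j≢a ∘ sym) a≢b))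

partner : ∀ {n} (f : Fin (suc n) → Bool) {a} → countOnes f ≤ 2 → ¬ countOnes f ≤ 1 → f a ≡ true →
  ∃ λ b → OnesAt f a b
partner f {a} count≤2 count≰1 fa≡true with allFalse⊎someTrue (f ∘ punchIn a)
... | inj₁ allFalse = ⊥-elim (count≰1 (ℕ.≤-reflexive
        (trans (countOnes-punchIn-true f fa≡true) (cong suc (countOnes-allFalse _ allFalse)))))
... | inj₂ (l , fl≡true) = punchIn a l , onesAt-of-countOnes≤2 f count≤2 (punchInᵢ≢i a l ∘ sym) fa≡true fl≡true

onesAt-sym : ∀ {n} {f : Fin n → Bool} {a b} → OnesAt f a b → OnesAt f b a
onesAt-sym (onesAt a≢b fa fb rest) = onesAt (a≢b ∘ sym) fb fa (λ j j≢b j≢a → rest j j≢a j≢b)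

onesAt-ext : ∀ {n} {f g : Fin n → Bool} {a b} → OnesAt f a b → OnesAt g a b → ∀ j → f j ≡ g j
onesAt-ext {a = a} {b} (onesAt _ fa fb f-rest) (onesAt _ ga gb g-rest) j with j ≟ a | j ≟ b
... | yes refl | _        = trans fa (sym ga)
... | no _     | yes refl = trans fb (sym gb)
... | no j≢a   | no j≢b   = trans (f-rest j j≢a j≢b) (sym (g-rest j j≢a j≢b))

onesAt-dropFirst : ∀ {n} {f : Fin (suc n) → Bool} {a b} (ab : OnesAt f a b) →
  OneAt (f ∘ punchIn a) (punchOut (OnesAt.distinct ab))
onesAt-dropFirst {f = f} (onesAt a≢b fa fb rest) =
  oneAt (trans (cong f (punchIn-punchOut a≢b)) fb)
        (λ l l≢b′ → rest _ (punchInᵢ≢i _ l) (punchIn≢-of-≢punchOut a≢b l≢b′))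

onesAt-dropOther : ∀ {n} {f : Fin (suc n) → Bool} {a b c} (ab : OnesAt f a b) (c≢a : c ≢ a) (c≢b : c ≢ b) →
  OnesAt (f ∘ punchIn c) (punchOut c≢a) (punchOut c≢b)
onesAt-dropOther {f = f} (onesAt a≢b fa fb rest) c≢a c≢b =
  onesAt (a≢b ∘ punchOut-injective c≢a c≢b)
         (trans (cong f (punchIn-punchOut c≢a)) fa)
         (trans (cong f (punchIn-punchOut c≢b)) fb)
         (λ l l≢a′ l≢b′ → rest _ (punchIn≢-of-≢punchOut c≢a l≢a′) (punchIn≢-of-≢punchOut c≢b l≢b′))

countOnes≡sum : ∀ {n} (f : Fin n → Bool) → countOnes f ≡ sum (ind ∘ f)
countOnes≡sum {zero}  f = refl
countOnes≡sum {suc n} f = cong (ind (f zero) ℕ.+_) (countOnes≡sum (f ∘ suc))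

sum-mono-≤ : ∀ {n} {f g : Fin n → ℕ} → (∀ j → f j ≤ g j) → sum f ≤ sum g
sum-mono-≤ {zero}  f≤g = z≤n
sum-mono-≤ {suc n} f≤g = ℕ.+-mono-≤ (f≤g zero) (sum-mono-≤ (f≤g ∘ suc))

sum-const : ∀ n c → sum {n} (λ _ → c) ≡ n ℕ.* c
sum-const zero    c = refl
sum-const (suc n) c = cong (c ℕ.+_) (sum-const n c)

RowsAtMostTwo : ∀ {n} → BoolMatrix n → Set
RowsAtMostTwo A = ∀ i → countOnes (A i) ≤ 2

ones-by-columns≡ones-by-rows : ∀ {n} (A : BoolMatrix n) →
  sum (λ c → countOnes (λ i → A i c)) ≡ sum (λ i → countOnes (A i))
ones-by-columns≡ones-by-rows A = begin
  sum (λ c → countOnes (λ i → A i c))     ≡⟨ sum-cong-≗ (λ c → countOnes≡sum (λ i → A i c)) ⟩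
  sum (λ c → sum (λ i → ind (A i c)))     ≡⟨ ∑-comm (λ c i → ind (A i c)) ⟩
  sum (λ i → sum (λ c → ind (A i c)))     ≡⟨ sum-cong-≗ (λ i → countOnes≡sum (A i)) ⟨
  sum (λ i → countOnes (A i))             ∎
  where open ≡-Reasoning

lightColumn : ∀ {n} (A : BoolMatrix (suc n)) → RowsAtMostTwo A → ∃ λ c → countOnes (λ i → A i c) ≤ 2
lightColumn {n} A rows≤2 with any? (λ c → countOnes (λ i → A i c) ℕ.≤? 2)
... | yes light  = light
... | no noLight = ⊥-elim (3≰2 (ℕ.*-cancelˡ-≤ (suc n) (begin
  suc n ℕ.* 3                          ≡⟨ sum-const (suc n) 3 ⟨
  sum {suc n} (λ _ → 3)                ≤⟨ sum-mono-≤ (λ c → ℕ.≰⇒> (noLight ∘ (c ,_))) ⟩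
  sum (λ c → countOnes (λ i → A i c))  ≡⟨ ones-by-columns≡ones-by-rows A ⟩
  sum (λ i → countOnes (A i))          ≤⟨ sum-mono-≤ {g = λ _ → 2} rows≤2 ⟩
  sum {suc n} (λ _ → 2)                ≡⟨ sum-const (suc n) 2 ⟩
  suc n ℕ.* 2                          ∎)))
  where
  open ℕ.≤-Reasoning
  3≰2 : ¬ 3 ≤ 2
  3≰2 (s≤s (s≤s ()))

⟦_⟧ : ∀ {n} → BoolMatrix n → Matrix n
⟦ A ⟧ i j = toℤ (A i j)

minor-rowsAtMostTwo : ∀ {n} (A : BoolMatrix (suc n)) r c → RowsAtMostTwo A → RowsAtMostTwo (minor A r c)
minor-rowsAtMostTwo A r c rows≤2 i = ℕ.≤-trans (countOnes-punchIn-≤ (A (punchIn r i)) c) (rows≤2 (punchIn r i))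

∣det∣-oneAt : ∀ {n} (A : BoolMatrix (suc n)) r {c} → OneAt (A r) c →
  ∣ det ⟦ A ⟧ ∣ ≡ ∣ det ⟦ minor A r c ⟧ ∣
∣det∣-oneAt A r {c} (oneAt hit rest) =
  ∣det∣-singleEntry ⟦ A ⟧ r c (cong toℤ hit) (λ j j≢c → cong toℤ (rest j j≢c))

∣det∣-onesAt : ∀ {n} (A : BoolMatrix (suc n)) r {a b} → OnesAt (A r) a b →
  ∣ det ⟦ A ⟧ ∣ ≤ ∣ det ⟦ minor A r a ⟧ ∣ ℕ.+ ∣ det ⟦ minor A r b ⟧ ∣
∣det∣-onesAt A r (onesAt a≢b hit₁ hit₂ rest) =
  ∣det∣-twoEntries ⟦ A ⟧ r a≢b (cong toℤ hit₁) (cong toℤ hit₂) (λ j j≢a j≢b → cong toℤ (rest j j≢a j≢b))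

∣det∣-pendant : ∀ {n} (A : BoolMatrix (suc n)) r {a b} → OnesAt (A r) a b →
  (∀ l → A (punchIn r l) b ≡ false) → ∣ det ⟦ A ⟧ ∣ ≤ ∣ det ⟦ minor A r b ⟧ ∣
∣det∣-pendant A r {a} {b} ab colB = begin
  ∣ det ⟦ A ⟧ ∣                                              ≤⟨ ∣det∣-onesAt A r ab ⟩
  ∣ det ⟦ minor A r a ⟧ ∣ ℕ.+ ∣ det ⟦ minor A r b ⟧ ∣        ≡⟨ cong (λ d → ∣ d ∣ ℕ.+ ∣ det ⟦ minor A r b ⟧ ∣) minor≡0 ⟩
  ∣ det ⟦ minor A r b ⟧ ∣                                    ∎
  where
  open ℕ.≤-Reasoning
  a≢b = OnesAt.distinct ab
  minor≡0 : det ⟦ minor A r a ⟧ ≡ 0ℤ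
  minor≡0 = det-zeroColumn ⟦ minor A r a ⟧ (punchOut a≢b)
    (λ l → cong toℤ (trans (cong (A (punchIn r l)) (punchIn-punchOut a≢b)) (colB l)))

DetBound : ℕ → Set
DetBound n = (A : BoolMatrix n) → RowsAtMostTwo A → ∣ det ⟦ A ⟧ ∣ ^ 3 ≤ 2 ^ n

bound-det≡0 : ∀ {d m} → d ≡ 0ℤ → ∣ d ∣ ^ 3 ≤ m
bound-det≡0 refl = z≤n

cube-of-sum≤-ordered : ∀ {d x y} p → x ≤ y → d ≤ x ℕ.+ y → y ^ 3 ℕ.* 2 ≤ 2 ^ p → d ^ 3 ≤ 2 ^ suc (suc p)
cube-of-sum≤-ordered {d} {x} {y} p x≤y d≤x+y y-bound = begin
  d ^ 3                 ≤⟨ ℕ.^-monoˡ-≤ 3 (ℕ.≤-trans d≤x+y (ℕ.+-monoˡ-≤ y x≤y)) ⟩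
  (y ℕ.+ y) ^ 3         ≡⟨ double-cube y ⟩
  4 ℕ.* (y ^ 3 ℕ.* 2)   ≤⟨ ℕ.*-monoʳ-≤ 4 y-bound ⟩
  4 ℕ.* 2 ^ p           ≡⟨ four (2 ^ p) ⟩
  2 ^ suc (suc p)       ∎
  where
  open ℕ.≤-Reasoning
  expanded : ∀ y → (y ℕ.+ y) ℕ.* ((y ℕ.+ y) ℕ.* ((y ℕ.+ y) ℕ.* 1)) ≡ 4 ℕ.* (y ℕ.* (y ℕ.* (y ℕ.* 1)) ℕ.* 2)
  expanded = ℕ-Solver.solve-∀
  double-cube : ∀ y → (y ℕ.+ y) ^ 3 ≡ 4 ℕ.* (y ^ 3 ℕ.* 2)
  double-cube = expanded
  four : ∀ z → 4 ℕ.* z ≡ 2 ℕ.* (2 ℕ.* z)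
  four = ℕ-Solver.solve-∀

cube-of-sum≤ : ∀ {d} p x y → d ≤ x ℕ.+ y → x ^ 3 ℕ.* 2 ≤ 2 ^ p → y ^ 3 ℕ.* 2 ≤ 2 ^ p →
  d ^ 3 ≤ 2 ^ suc (suc p)
cube-of-sum≤ p x y d≤x+y x-bound y-bound with ℕ.≤-total x y
... | inj₁ x≤y = cube-of-sum≤-ordered p x≤y d≤x+y y-bound
... | inj₂ y≤x = cube-of-sum≤-ordered p y≤x (ℕ.≤-trans d≤x+y (ℕ.≤-reflexive (ℕ.+-comm x y))) x-bound

bound-deficientRow : ∀ {n} → DetBound (ℕ.pred n) → (A : BoolMatrix n) → RowsAtMostTwo A →
  ∀ r → countOnes (A r) ≤ 1 → ∣ det ⟦ A ⟧ ∣ ^ 3 ℕ.* 2 ≤ 2 ^ n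
bound-deficientRow {suc n} bound A rows≤2 r row≤1 with allFalse⊎someTrue (A r)
... | inj₁ allFalse rewrite det-zeroRow ⟦ A ⟧ r (λ j → cong toℤ (allFalse j)) = z≤n
... | inj₂ (c , hit) = begin
  ∣ det ⟦ A ⟧ ∣ ^ 3 ℕ.* 2            ≡⟨ cong (λ d → d ^ 3 ℕ.* 2) (∣det∣-oneAt A r (oneAt-of-countOnes≤1 (A r) row≤1 hit)) ⟩
  ∣ det ⟦ minor A r c ⟧ ∣ ^ 3 ℕ.* 2  ≤⟨ ℕ.*-monoˡ-≤ 2 (bound (minor A r c) (minor-rowsAtMostTwo A r c rows≤2)) ⟩
  2 ^ n ℕ.* 2                        ≡⟨ ℕ.*-comm (2 ^ n) 2 ⟩
  2 ^ suc n                          ∎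
  where open ℕ.≤-Reasoning

bound-pendant : ∀ {n} → DetBound n → (A : BoolMatrix (suc n)) → RowsAtMostTwo A →
  ∀ {r a b} → OnesAt (A r) a b → (∀ l → A (punchIn r l) b ≡ false) → ∣ det ⟦ A ⟧ ∣ ^ 3 ≤ 2 ^ suc n
bound-pendant {n} bound A rows≤2 {r} {a} {b} ab colB = begin
  ∣ det ⟦ A ⟧ ∣ ^ 3            ≤⟨ ℕ.^-monoˡ-≤ 3 (∣det∣-pendant A r ab colB) ⟩
  ∣ det ⟦ minor A r b ⟧ ∣ ^ 3  ≤⟨ bound (minor A r b) (minor-rowsAtMostTwo A r b rows≤2) ⟩
  2 ^ n                        ≤⟨ ℕ.m≤m+n (2 ^ n) _ ⟩
  2 ^ suc n                    ∎
  where open ℕ.≤-Reasoning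

bound-chain : ∀ {n} → DetBound (ℕ.pred (ℕ.pred n)) → (A : BoolMatrix (suc n)) → RowsAtMostTwo A →
  ∀ {r l₀ a b x} → OnesAt (A r) a b → OnesAt (A (punchIn r l₀)) a x → x ≢ b →
  (∀ j → j ≢ r → j ≢ punchIn r l₀ → A j a ≡ false) →
  (∃ λ l → A (punchIn r l) b ≡ true) → (∃ λ l → A (punchIn (punchIn r l₀) l) x ≡ true) →
  ∣ det ⟦ A ⟧ ∣ ^ 3 ≤ 2 ^ suc n
bound-chain {suc q} bound A rows≤2 {r} {l₀} {a} {b} {x} rowR rowI x≢b colA (l₁ , hit-b) (l₂ , hit-x) =
  cube-of-sum≤ q ∣ det ⟦ C ⟧ ∣ ∣ det ⟦ C′ ⟧ ∣ split
    (bound-deficientRow bound C  rows-C  (proj₁ below-x) deficient-C)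
    (bound-deficientRow bound C′ rows-C′ (proj₁ below-b) deficient-C′)
  where
  open ℕ.≤-Reasoning
  i = punchIn r l₀
  a≢x = OnesAt.distinct rowI
  b≢a = OnesAt.distinct rowR ∘ sym
  b≢x = x≢b ∘ sym
  C  = minor (minor A r a) l₀ (punchOut a≢x)
  C′ = minor (minor A r b) l₀ (punchOut b≢a)
  rows-C : RowsAtMostTwo C
  rows-C = minor-rowsAtMostTwo (minor A r a) l₀ _ (minor-rowsAtMostTwo A r a rows≤2)
  rows-C′ : RowsAtMostTwo C′
  rows-C′ = minor-rowsAtMostTwo (minor A r b) l₀ _ (minor-rowsAtMostTwo A r b rows≤2)
  colA′ : ∀ k → minor A r b (punchIn l₀ k) (punchOut b≢a) ≡ false
  colA′ k = trans (cong (A (punchIn r (punchIn l₀ k))) (punchIn-punchOut b≢a))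
                  (colA _ (punchInᵢ≢i r _) (punchInᵢ≢i l₀ k ∘ punchIn-injective r _ _))
  split : ∣ det ⟦ A ⟧ ∣ ≤ ∣ det ⟦ C ⟧ ∣ ℕ.+ ∣ det ⟦ C′ ⟧ ∣
  split = begin
    ∣ det ⟦ A ⟧ ∣                                        ≤⟨ ∣det∣-onesAt A r rowR ⟩
    ∣ det ⟦ minor A r a ⟧ ∣ ℕ.+ ∣ det ⟦ minor A r b ⟧ ∣  ≤⟨ ℕ.+-mono-≤
        (ℕ.≤-reflexive (∣det∣-oneAt (minor A r a) l₀ (onesAt-dropFirst rowI)))
        (∣det∣-pendant (minor A r b) l₀ (onesAt-dropOther (onesAt-sym rowI) b≢x b≢a) colA′) ⟩
    ∣ det ⟦ C ⟧ ∣ ℕ.+ ∣ det ⟦ C′ ⟧ ∣                      ∎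
  below : ∀ {c j} → j ≢ r → j ≢ i → A j c ≡ true → ∃ λ k → A (punchIn r (punchIn l₀ k)) c ≡ true
  below {c} j≢r j≢i hit with punchIn²-surjective j≢r j≢i
  ... | k , eq = k , subst (λ j → A j c ≡ true) (sym eq) hit
  below-x = below (distinct-by (λ j → A j x) hit-x (OnesAt.rest rowR x (a≢x ∘ sym) x≢b)) (punchInᵢ≢i i l₂) hit-x
  below-b = below (punchInᵢ≢i r l₁) (distinct-by (λ j → A j b) hit-b (OnesAt.rest rowI b b≢a b≢x)) hit-b
  deficient-C : countOnes (C (proj₁ below-x)) ≤ 1
  deficient-C = countOnes-dropTwo≤1 (A _) a (punchOut a≢x) (rows≤2 _)
    (inj₂ (trans (cong (A _) (punchIn-punchOut a≢x)) (proj₂ below-x)))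
  deficient-C′ : countOnes (C′ (proj₁ below-b)) ≤ 1
  deficient-C′ = countOnes-dropTwo≤1 (A _) b (punchOut b≢a) (rows≤2 _) (inj₁ (proj₂ below-b))

bound-sharedColumn : ∀ {n} → DetBound n → DetBound (ℕ.pred (ℕ.pred n)) → (A : BoolMatrix (suc n)) →
  RowsAtMostTwo A → ∀ {r l₀ a b x} → OnesAt (A r) a b → OnesAt (A (punchIn r l₀)) a x →
  (∀ j → j ≢ r → j ≢ punchIn r l₀ → A j a ≡ false) → ∣ det ⟦ A ⟧ ∣ ^ 3 ≤ 2 ^ suc n
bound-sharedColumn bound bound₂ A rows≤2 {r} {l₀} {a} {b} {x} rowR rowI colA with x ≟ b
... | yes refl = bound-det≡0
  (det-equalRows ⟦ A ⟧ (punchInᵢ≢i r l₀ ∘ sym) (λ j → cong toℤ (onesAt-ext rowR rowI j)))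
... | no x≢b
  with allFalse⊎someTrue (λ l → A (punchIn r l) b) | allFalse⊎someTrue (λ l → A (punchIn (punchIn r l₀) l) x)
... | inj₁ colB  | _          = bound-pendant bound A rows≤2 rowR colB
... | inj₂ _     | inj₁ colX  = bound-pendant bound A rows≤2 rowI colX
... | inj₂ hit-b | inj₂ hit-x = bound-chain bound₂ A rows≤2 rowR rowI x≢b colA hit-b hit-x

bound-column : ∀ {n} → DetBound n → DetBound (ℕ.pred (ℕ.pred n)) → (A : BoolMatrix (suc n)) →
  RowsAtMostTwo A → (∀ i → ¬ countOnes (A i) ≤ 1) →
  ∀ {a r} → countOnes (λ i → A i a) ≤ 2 → A r a ≡ true → ∣ det ⟦ A ⟧ ∣ ^ 3 ≤ 2 ^ suc n
bound-column bound bound₂ A rows≤2 full {a} {r} col≤2 hit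
  with partner (A r) (rows≤2 r) (full r) hit | allFalse⊎someTrue (λ l → A (punchIn r l) a)
... | b , rowR | inj₁ colA = bound-pendant bound A rows≤2 (onesAt-sym rowR) colA
... | b , rowR | inj₂ (l₀ , hit₀) with partner (A (punchIn r l₀)) (rows≤2 _) (full _) hit₀
...   | x , rowI = bound-sharedColumn bound bound₂ A rows≤2 rowR rowI
        (OnesAt.rest (onesAt-of-countOnes≤2 (λ i → A i a) col≤2 (punchInᵢ≢i r l₀ ∘ sym) hit hit₀))

bound-noDeficientRow : ∀ {n} → DetBound n → DetBound (ℕ.pred (ℕ.pred n)) → (A : BoolMatrix (suc n)) →
  RowsAtMostTwo A → (∀ i → ¬ countOnes (A i) ≤ 1) → ∣ det ⟦ A ⟧ ∣ ^ 3 ≤ 2 ^ suc n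
bound-noDeficientRow bound bound₂ A rows≤2 full with lightColumn A rows≤2
... | a , col≤2 with allFalse⊎someTrue (λ i → A i a)
...   | inj₁ colA      = bound-det≡0 (det-zeroColumn ⟦ A ⟧ a (λ i → cong toℤ (colA i)))
...   | inj₂ (r , hit) = bound-column bound bound₂ A rows≤2 full col≤2 hit

bound-suc : ∀ {n} → DetBound n → DetBound (ℕ.pred (ℕ.pred n)) → DetBound (suc n)
bound-suc bound bound₂ A rows≤2 with any? (λ r → countOnes (A r) ℕ.≤? 1)
... | yes (r , row≤1) = ℕ.≤-trans (ℕ.m≤m*n _ 2) (bound-deficientRow bound A rows≤2 r row≤1)
... | no noDeficient  = bound-noDeficientRow bound bound₂ A rows≤2 (λ r row≤1 → noDeficient (r , row≤1))

detBound : ∀ n → DetBound n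
detBound zero                A _ = ℕ.≤-refl
detBound (suc zero)              = bound-suc (detBound 0) (detBound 0)
detBound (suc (suc zero))        = bound-suc (detBound 1) (detBound 0)
detBound (suc (suc (suc m)))     = bound-suc (detBound (suc (suc m))) (detBound m)

proposition5 : (n : ℕ) → .{{_ : NonZero n}} → (A : BoolMatrix n)
    → (∀ (i : Fin n) → countOnes (A i) ≤ 2)
    → ∣ det (λ i j → toℤ (A i j)) ∣ ^ 3 ≤ 2 ^ n
proposition5 n = detBound n
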